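{- Let $Q$ be a quiver on nodes $1,\dots,N$ with matrix $B_Q$ such that node $1$ is a sink of $Q$ and node $2$ is a sink of $Q(2)$, the quiver with matrix $\mu_1B_Q$. Then $Q$ has period $2$, i.e. $\mu_2\mu_1B_Q=\rho^2B_Q\rho^{ -2}$, if and only if $\tau^2B_Q\tau^{ -2}=B_Q$.
   Context: A quiver on nodes $1,\dots,N$ (no loops, no $2$-cycles) is identified with the skew-symmetric integer matrix $B=(b_{ij})$, $b_{ij}$ = number of arrows $i\to j$ minus number of arrows $j\to i$. Mutation at $k$: $\mu_kB=\tilde B$ with $\tilde b_{ij}=-b_{ij}$ if $i=k$ or $j=k$, and $\tilde b_{ij}=b_{ij}+\frac12(|b_{ik}|b_{kj}+b_{ik}|b_{kj}|)$ otherwise. $\rho$ is the permutation matrix with $\rho_{i+1,i}=1$ ($1\le i\le N-1$), $\rho_{1,N}=1$, other entries $0$. $\tau$ is the matrix with $\tau_{i+1,i}=1$ ($1\le i\le N-1$), $\tau_{1,N}=-1$, other entries $0$. Node $i$ is a sink if $b_{ij}\le0$ for all $j$. -}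

module Defs where

open import Data.Nat as ℕ using (ℕ; zero; suc)
open import Data.Fin using (Fin; zero; suc; toℕ; fromℕ)
open import Data.Integer using (ℤ; +_; -_; _+_; _*_; _≤_; ∣_∣; _/ℕ_)
open import Relation.Nullary using (yes; no)
open import Relation.Nullary.Decidable using (⌊_⌋)
open import Data.Bool using (Bool; true; false; if_then_else_; _∨_; _∧_)
open import Relation.Binary.PropositionalEquality using (_≡_)

-- N × N integer matrices, indices Fin N (node i of the paper = Fin index i-1)
Mat : ℕ → Set
Mat N = Fin N → Fin N → ℤ

Skew : ∀ {N} → Mat N → Set
Skew B = ∀ i j → B i j ≡ - B j i

sumFin : ∀ {n} → (Fin n → ℤ) → ℤ
sumFin {zero}  f = + 0
sumFin {suc n} f = f zero + sumFin (λ i → f (suc i))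

infixl 7 _⊗_
_⊗_ : ∀ {N} → Mat N → Mat N → Mat N
(A ⊗ B) i j = sumFin (λ k → A i k * B k j)

transpose : ∀ {N} → Mat N → Mat N
transpose A i j = A j i

μ : ∀ {N} → Fin N → Mat N → Mat N
μ k B i j with ⌊ i Data.Fin.≟ k ⌋ ∨ ⌊ j Data.Fin.≟ k ⌋
... | true  = - B i j
... | false = B i j + ((+ ∣ B i k ∣) * B k j + B i k * (+ ∣ B k j ∣)) /ℕ 2

-- ρ : ρ_{i+1,i} = 1 (1 ≤ i ≤ N-1), ρ_{1,N} = 1, others 0   (0-indexed here)
ρ : ∀ {N} → Mat N
ρ {zero} ()
ρ {suc n} i j =
  if ⌊ toℕ i ℕ.≟ suc (toℕ j) ⌋ then + 1
  else if ⌊ toℕ i ℕ.≟ 0 ⌋ ∧ ⌊ toℕ j ℕ.≟ n ⌋ then + 1 else + 0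

τ : ∀ {N} → Mat N
τ {zero} ()
τ {suc n} i j =
  if ⌊ toℕ i ℕ.≟ suc (toℕ j) ⌋ then + 1
  else if ⌊ toℕ i ℕ.≟ 0 ⌋ ∧ ⌊ toℕ j ℕ.≟ n ⌋ then - (+ 1) else + 0

-- ρ and τ are signed permutation matrices, hence orthogonal: their inverses
-- are their transposes.
ρ⁻¹ : ∀ {N} → Mat N
ρ⁻¹ = transpose ρ

τ⁻¹ : ∀ {N} → Mat N
τ⁻¹ = transpose τ

IsSink : ∀ {N} → Mat N → Fin N → Set
IsSink B i = ∀ j → B i j ≤ + 0

infix 4 _≐_
_≐_ : ∀ {N} → Mat N → Mat N → Set
A ≐ B = ∀ i j → A i j ≡ B i j

-- Mutating a skew-symmetric matrix at a sink k only flips the signs of row and column k,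
-- since every correction term |b_ik| b_kj + b_ik |b_kj| vanishes (b_ik ≥ 0 ≥ b_kj).
-- Hence μ₂μ₁B = DBD with D = diag(-1,-1,1,…,1). Both ρ and τ are monomial matrices
-- with support i ↦ i-1 (mod N), so ρ²Bρ⁻² and τ²Bτ⁻² are B re-indexed by i ↦ i-2,
-- and the two entries -1 of τ make τ²Bτ⁻² = D(ρ²Bρ⁻²)D. As D² = 1, the conditions
-- DBD = ρ²Bρ⁻² and D(ρ²Bρ⁻²)D = B are equivalent.
module Submission where

open import Defs
open import Data.Nat as ℕ using (ℕ; zero; suc)
open import Data.Fin as Fin using (Fin; zero; suc; toℕ; fromℕ; inject₁)
import Data.Nat.Properties as ℕ
open import Data.Fin.Properties using (toℕ-fromℕ; toℕ-inject₁; toℕ-injective; suc-injective)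
open import Data.Integer using (ℤ; +_; -_; _+_; _*_; _≤_; ∣_∣)
open import Data.Integer.Properties
  using (+-identityˡ; +-identityʳ; *-zeroʳ; *-comm; ∣-i∣≡∣i∣; 0≤i⇒+∣i∣≡i; neg-mono-≤)
open import Data.Integer.Tactic.RingSolver using (solve-∀)
open import Data.Bool using (if_then_else_; _∧_)
open import Function using (_∘_)
open import Function.Bundles using (_⇔_; mk⇔)
open import Relation.Nullary using (yes; no; contradiction)
open import Relation.Nullary.Decidable using (⌊_⌋)
open import Relation.Binary.PropositionalEquality

variable
  N : ℕ

sumFin-zero : (f : Fin N → ℤ) → (∀ k → f k ≡ + 0) → sumFin f ≡ + 0
sumFin-zero {zero}  f f≡0 = refl
sumFin-zero {suc N} f f≡0
  rewrite f≡0 zero | sumFin-zero (f ∘ suc) (f≡0 ∘ suc) = refl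

sumFin-single : (f : Fin N → ℤ) (k₀ : Fin N) → (∀ k → k ≢ k₀ → f k ≡ + 0) → sumFin f ≡ f k₀
sumFin-single {suc N} f zero f≡0
  rewrite sumFin-zero (f ∘ suc) (λ k → f≡0 (suc k) λ ()) = +-identityʳ (f zero)
sumFin-single {suc N} f (suc k₀) f≡0
  rewrite f≡0 zero (λ ())
        | sumFin-single (f ∘ suc) k₀ (λ k k≢k₀ → f≡0 (suc k) (k≢k₀ ∘ suc-injective))
  = +-identityˡ (f (suc k₀))

SupportedOn : Mat N → (Fin N → Fin N) → Set
SupportedOn M p = ∀ i k → k ≢ p i → M i k ≡ + 0

⊗-supportedˡ : {M : Mat N} {p : Fin N → Fin N} → SupportedOn M p →
               ∀ A i j → (M ⊗ A) i j ≡ M i (p i) * A (p i) j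
⊗-supportedˡ {M = M} {p} supp A i j = sumFin-single (λ k → M i k * A k j) (p i)
  (λ k k≢pi → cong (_* A k j) (supp i k k≢pi))

⊗-supportedʳ : {M : Mat N} {q : Fin N → Fin N} → SupportedOn (transpose M) q →
               ∀ A i j → (A ⊗ M) i j ≡ A i (q j) * M (q j) j
⊗-supportedʳ {M = M} {q} supp A i j = sumFin-single (λ k → A i k * M k j) (q j)
  (λ k k≢qj → trans (cong (A i k *_) (supp j k k≢qj)) (*-zeroʳ (A i k)))

⊗-supportedOn : {M M′ : Mat N} {p q : Fin N → Fin N} →
                SupportedOn M p → SupportedOn M′ q → SupportedOn (M ⊗ M′) (q ∘ p)
⊗-supportedOn {M = M} {M′} {p} suppM suppM′ i k k≢qpi = begin
  (M ⊗ M′) i k           ≡⟨ ⊗-supportedˡ suppM M′ i k ⟩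
  M i (p i) * M′ (p i) k ≡⟨ cong (M i (p i) *_) (suppM′ (p i) k k≢qpi) ⟩
  M i (p i) * + 0        ≡⟨ *-zeroʳ (M i (p i)) ⟩
  + 0                    ∎
  where open ≡-Reasoning

transpose-⊗-supportedOn : {M M′ : Mat N} {p q : Fin N → Fin N} →
  SupportedOn M p → SupportedOn M′ q → SupportedOn (transpose (transpose M ⊗ transpose M′)) (p ∘ q)
transpose-⊗-supportedOn {M = M} {M′} {p} {q} suppM suppM′ j k k≢pqj = begin
  (transpose M ⊗ transpose M′) k j ≡⟨ ⊗-supportedʳ suppM′ (transpose M) k j ⟩
  M (q j) k * M′ j (q j)           ≡⟨ cong (_* M′ j (q j)) (suppM (q j) k k≢pqj) ⟩
  + 0                              ∎
  where open ≡-Reasoning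

conjugate-supported : {L R : Mat N} {p q : Fin N → Fin N} →
  SupportedOn L p → SupportedOn (transpose R) q →
  ∀ B i j → ((L ⊗ B) ⊗ R) i j ≡ L i (p i) * B (p i) (q j) * R (q j) j
conjugate-supported {L = L} {R} {p} {q} suppL suppR B i j = begin
  ((L ⊗ B) ⊗ R) i j                     ≡⟨ ⊗-supportedʳ suppR (L ⊗ B) i j ⟩
  (L ⊗ B) i (q j) * R (q j) j           ≡⟨ cong (_* R (q j) j) (⊗-supportedˡ suppL B i (q j)) ⟩
  L i (p i) * B (p i) (q j) * R (q j) j ∎
  where open ≡-Reasoning

cyclicPred : ∀ {m} → Fin (suc m) → Fin (suc m)
cyclicPred {m} zero = fromℕ m
cyclicPred (suc i) = inject₁ i

-- ρ and τ are definitionally cyclicShift (+ 1) and cyclicShift (- + 1).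
cyclicShift : ∀ {m} → ℤ → Mat (suc m)
cyclicShift {m} v i j =
  if ⌊ toℕ i ℕ.≟ suc (toℕ j) ⌋ then + 1
  else if ⌊ toℕ i ℕ.≟ 0 ⌋ ∧ ⌊ toℕ j ℕ.≟ m ⌋ then v else + 0

cornerOr1 : ∀ {m} → ℤ → Fin (suc m) → ℤ
cornerOr1 v zero    = v
cornerOr1 v (suc _) = + 1

cornerOr1-one : ∀ {m} (i : Fin (suc m)) → cornerOr1 (+ 1) i ≡ + 1
cornerOr1-one zero    = refl
cornerOr1-one (suc _) = refl

cyclicShift-supportedOn : ∀ {m} (v : ℤ) → SupportedOn (cyclicShift {m} v) cyclicPred
cyclicShift-supportedOn {m} v zero k k≢last with toℕ k ℕ.≟ m
... | yes k≡m = contradiction (toℕ-injective (trans k≡m (sym (toℕ-fromℕ m)))) k≢last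
... | no _    = refl
cyclicShift-supportedOn v (suc i) k k≢i with suc (toℕ i) ℕ.≟ suc (toℕ k)
... | yes i≡k = contradiction (toℕ-injective (trans (sym (ℕ.suc-injective i≡k)) (sym (toℕ-inject₁ i)))) k≢i
... | no _    = refl

cyclicShift-cyclicPred : ∀ {m} (v : ℤ) (i : Fin (suc m)) → cyclicShift v i (cyclicPred i) ≡ cornerOr1 v i
cyclicShift-cyclicPred {m} v zero with toℕ (fromℕ m) ℕ.≟ m
... | yes _     = refl
... | no last≢m = contradiction (toℕ-fromℕ m) last≢m
cyclicShift-cyclicPred v (suc i) with suc (toℕ i) ℕ.≟ suc (toℕ (inject₁ i))
... | yes _   = refl
... | no i≢i′ = contradiction (cong suc (sym (toℕ-inject₁ i))) i≢i′

≐-sym : {A C : Mat N} → A ≐ C → C ≐ A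
≐-sym A≐C i j = sym (A≐C i j)

≐-trans : {A C D : Mat N} → A ≐ C → C ≐ D → A ≐ D
≐-trans A≐C C≐D i j = trans (A≐C i j) (C≐D i j)

rescale : (Fin N → ℤ) → Mat N → Mat N
rescale s A i j = s i * A i j * s j

rescale-congʳ : (s : Fin N → ℤ) {A C : Mat N} → A ≐ C → rescale s A ≐ rescale s C
rescale-congʳ s A≐C i j = cong (λ x → s i * x * s j) (A≐C i j)

rescale-rescale : (s t : Fin N → ℤ) (A : Mat N) → rescale s (rescale t A) ≐ rescale (λ i → s i * t i) A
rescale-rescale s t A i j = regroup (s i) (t i) (A i j) (t j) (s j)
  where
  regroup : ∀ a b x c d → a * (b * x * c) * d ≡ a * b * x * (d * c)
  regroup = solve-∀

rescale-skew : (s : Fin N → ℤ) {A : Mat N} → Skew A → Skew (rescale s A)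
rescale-skew s {A} skew i j = trans (cong (λ x → s i * x * s j) (skew i j)) (swap (s i) (A j i) (s j))
  where
  swap : ∀ a x b → a * (- x) * b ≡ - (b * x * a)
  swap = solve-∀

rescale-by-one : (A : Mat N) → rescale (λ _ → + 1) A ≐ A
rescale-by-one A i j = unit (A i j)
  where
  unit : ∀ x → + 1 * x * + 1 ≡ x
  unit = solve-∀

rescale-congˡ : {s t : Fin N → ℤ} → (∀ i → s i ≡ t i) → ∀ A → rescale s A ≐ rescale t A
rescale-congˡ s≡t A i j = cong₂ (λ a b → a * A i j * b) (s≡t i) (s≡t j)

≐-skew : {A C : Mat N} → A ≐ C → Skew C → Skew A
≐-skew {A = A} {C} A≐C skew i j = begin
  A i j   ≡⟨ A≐C i j ⟩
  C i j   ≡⟨ skew i j ⟩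
  - C j i ≡⟨ cong -_ (A≐C j i) ⟨
  - A j i ∎
  where open ≡-Reasoning

SquaresToOne : (Fin N → ℤ) → Set
SquaresToOne s = ∀ i → s i * s i ≡ + 1

rescale-involutive : (s : Fin N → ℤ) → SquaresToOne s → ∀ A → rescale s (rescale s A) ≐ A
rescale-involutive s s²≡1 A i j = begin
  rescale s (rescale s A) i j  ≡⟨ rescale-rescale s s A i j ⟩
  s i * s i * A i j * (s j * s j) ≡⟨ cong₂ (λ a b → a * A i j * b) (s²≡1 i) (s²≡1 j) ⟩
  + 1 * A i j * + 1               ≡⟨ unit (A i j) ⟩
  A i j                           ∎
  where
  open ≡-Reasoning
  unit : ∀ x → + 1 * x * + 1 ≡ x
  unit = solve-∀

rescale-swap : (s : Fin N → ℤ) → SquaresToOne s → {A C : Mat N} → rescale s A ≐ C → rescale s C ≐ A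
rescale-swap s s²≡1 {A} {C} sA≐C i j = begin
  rescale s C i j             ≡⟨ rescale-congʳ s sA≐C i j ⟨
  rescale s (rescale s A) i j ≡⟨ rescale-involutive s s²≡1 A i j ⟩
  A i j                       ∎
  where open ≡-Reasoning

flipAt : Fin N → Fin N → ℤ
flipAt k i = if ⌊ i Fin.≟ k ⌋ then - + 1 else + 1

i≤0⇒+∣i∣≡-i : ∀ x → x ≤ + 0 → + ∣ x ∣ ≡ - x
i≤0⇒+∣i∣≡-i x x≤0 = trans (cong +_ (sym (∣-i∣≡∣i∣ x))) (0≤i⇒+∣i∣≡i (neg-mono-≤ x≤0))

sink-correction-vanishes : {B : Mat N} {k : Fin N} → Skew B → IsSink B k →
  ∀ i j → + ∣ B i k ∣ * B k j + B i k * + ∣ B k j ∣ ≡ + 0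
sink-correction-vanishes {B = B} {k} skew sink i j = begin
  + ∣ B i k ∣ * B k j + B i k * + ∣ B k j ∣ ≡⟨ cong₂ (λ a b → a * B k j + B i k * b) ∣Bik∣ ∣Bkj∣ ⟩
  B i k * B k j + B i k * - B k j           ≡⟨ cancel (B i k) (B k j) ⟩
  + 0                                       ∎
  where
  open ≡-Reasoning
  cancel : ∀ a b → a * b + a * - b ≡ + 0
  cancel = solve-∀
  ∣Bkj∣ : + ∣ B k j ∣ ≡ - B k j
  ∣Bkj∣ = i≤0⇒+∣i∣≡-i (B k j) (sink j)
  ∣Bik∣ : + ∣ B i k ∣ ≡ B i k
  ∣Bik∣ = begin
    + ∣ B i k ∣   ≡⟨ cong (λ x → + ∣ x ∣) (skew i k) ⟩
    + ∣ - B k i ∣ ≡⟨ cong +_ (∣-i∣≡∣i∣ (B k i)) ⟩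
    + ∣ B k i ∣   ≡⟨ i≤0⇒+∣i∣≡-i (B k i) (sink i) ⟩
    - B k i       ≡⟨ skew i k ⟨
    B i k         ∎

μ-sink : {B : Mat N} {k : Fin N} → Skew B → IsSink B k → μ k B ≐ rescale (flipAt k) B
μ-sink {B = B} {k} skew sink i j with i Fin.≟ k | j Fin.≟ k
... | yes refl | yes refl = trans (sym (skew i i)) (flip-flip (B i i))
  where
  flip-flip : ∀ x → x ≡ - + 1 * x * - + 1
  flip-flip = solve-∀
... | yes refl | no _ = flip-left (B i j)
  where
  flip-left : ∀ x → - x ≡ - + 1 * x * + 1
  flip-left = solve-∀
... | no _ | yes refl = flip-right (B i j)
  where
  flip-right : ∀ x → - x ≡ + 1 * x * - + 1
  flip-right = solve-∀
... | no _ | no _ rewrite sink-correction-vanishes skew sink i j = keep (B i j)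
  where
  keep : ∀ x → x + + 0 ≡ + 1 * x * + 1
  keep = solve-∀

μ-sink-sink : {B : Mat N} {k l : Fin N} → Skew B → IsSink B k → IsSink (μ k B) l →
  μ l (μ k B) ≐ rescale (λ i → flipAt l i * flipAt k i) B
μ-sink-sink {B = B} {k} {l} skew sinkₖ sinkₗ i j = begin
  μ l (μ k B) i j                             ≡⟨ μ-sink skew-μₖB sinkₗ i j ⟩
  rescale (flipAt l) (μ k B) i j              ≡⟨ rescale-congʳ (flipAt l) (μ-sink skew sinkₖ) i j ⟩
  rescale (flipAt l) (rescale (flipAt k) B) i j ≡⟨ rescale-rescale (flipAt l) (flipAt k) B i j ⟩
  rescale (λ i → flipAt l i * flipAt k i) B i j ∎
  where
  open ≡-Reasoning
  skew-μₖB : Skew (μ k B)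
  skew-μₖB = ≐-skew (μ-sink skew sinkₖ) (rescale-skew (flipAt k) skew)

reindex : (Fin N → Fin N) → Mat N → Mat N
reindex f A i j = A (f i) (f j)

cyclicPred² : ∀ {m} → Fin (suc m) → Fin (suc m)
cyclicPred² = cyclicPred ∘ cyclicPred

shiftWeight : ∀ {m} → ℤ → Fin (suc m) → ℤ
shiftWeight v i = cornerOr1 v i * cornerOr1 v (cyclicPred i)

cyclicShift-conjugate² : ∀ {m} (v : ℤ) (B : Mat (suc m)) →
  let S = cyclicShift v in
  ((S ⊗ S) ⊗ B) ⊗ (transpose S ⊗ transpose S) ≐ rescale (shiftWeight v) (reindex cyclicPred² B)
cyclicShift-conjugate² v B i j = begin
  (((S ⊗ S) ⊗ B) ⊗ (transpose S ⊗ transpose S)) i j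
    ≡⟨ conjugate-supported (⊗-supportedOn supp supp) (transpose-⊗-supportedOn supp supp) B i j ⟩
  (S ⊗ S) i (cyclicPred² i) * B (cyclicPred² i) (cyclicPred² j) * (transpose S ⊗ transpose S) (cyclicPred² j) j
    ≡⟨ cong₂ (λ a b → a * B (cyclicPred² i) (cyclicPred² j) * b) (left-weight i) (right-weight j) ⟩
  shiftWeight v i * B (cyclicPred² i) (cyclicPred² j) * shiftWeight v j ∎
  where
  open ≡-Reasoning
  S = cyclicShift v
  supp = cyclicShift-supportedOn v
  diagonal : ∀ i → S i (cyclicPred i) * S (cyclicPred i) (cyclicPred² i) ≡ shiftWeight v i
  diagonal i = cong₂ _*_ (cyclicShift-cyclicPred v i) (cyclicShift-cyclicPred v (cyclicPred i))
  left-weight : ∀ i → (S ⊗ S) i (cyclicPred² i) ≡ shiftWeight v i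
  left-weight i = trans (⊗-supportedˡ supp S i (cyclicPred² i)) (diagonal i)
  right-weight : ∀ j → (transpose S ⊗ transpose S) (cyclicPred² j) j ≡ shiftWeight v j
  right-weight j = begin
    (transpose S ⊗ transpose S) (cyclicPred² j) j                ≡⟨ ⊗-supportedʳ supp (transpose S) (cyclicPred² j) j ⟩
    S (cyclicPred j) (cyclicPred² j) * S j (cyclicPred j)         ≡⟨ *-comm (S (cyclicPred j) (cyclicPred² j)) (S j (cyclicPred j)) ⟩
    S j (cyclicPred j) * S (cyclicPred j) (cyclicPred² j)         ≡⟨ diagonal j ⟩
    shiftWeight v j                                               ∎

flip₀₁ : ∀ {m} → Fin (suc (suc m)) → ℤ
flip₀₁ i = flipAt (suc zero) i * flipAt zero i

flip₀₁-squaresToOne : ∀ {m} → SquaresToOne (flip₀₁ {m})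
flip₀₁-squaresToOne zero          = refl
flip₀₁-squaresToOne (suc zero)    = refl
flip₀₁-squaresToOne (suc (suc _)) = refl

shiftWeight-one : ∀ {m} (i : Fin (suc m)) → shiftWeight (+ 1) i ≡ + 1
shiftWeight-one i = cong₂ _*_ (cornerOr1-one i) (cornerOr1-one (cyclicPred i))

-- τ² has its two entries -1 in rows 1 and 2, exactly the rows whose signs μ₂μ₁ flips.
shiftWeight-minusOne : ∀ {m} (i : Fin (suc (suc m))) → shiftWeight (- + 1) i ≡ flip₀₁ i
shiftWeight-minusOne zero          = refl
shiftWeight-minusOne (suc zero)    = refl
shiftWeight-minusOne (suc (suc _)) = refl

mainTheorem3 : (n : ℕ) (B : Mat (suc (suc n))) → Skew B →
    IsSink B zero → IsSink (μ zero B) (suc zero) →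
    (μ (suc zero) (μ zero B) ≐ ((ρ ⊗ ρ) ⊗ B) ⊗ (ρ⁻¹ ⊗ ρ⁻¹))
      ⇔ ((((τ ⊗ τ) ⊗ B) ⊗ (τ⁻¹ ⊗ τ⁻¹)) ≐ B)
mainTheorem3 n B skew sink₀ sink₁ = mk⇔
  (λ period → ≐-trans τ-conj (rescale-swap flip₀₁ flip₀₁-squaresToOne
                (≐-trans (≐-sym μ-conj) (≐-trans period ρ-conj))))
  (λ τ-fixed → ≐-trans μ-conj (≐-trans (rescale-swap flip₀₁ flip₀₁-squaresToOne
                (≐-trans (≐-sym τ-conj) τ-fixed)) (≐-sym ρ-conj)))
  where
  B₂ = reindex cyclicPred² B
  μ-conj : μ (suc zero) (μ zero B) ≐ rescale flip₀₁ B
  μ-conj = μ-sink-sink skew sink₀ sink₁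
  ρ-conj : ((ρ ⊗ ρ) ⊗ B) ⊗ (ρ⁻¹ ⊗ ρ⁻¹) ≐ B₂
  ρ-conj = ≐-trans (cyclicShift-conjugate² (+ 1) B)
             (≐-trans (rescale-congˡ shiftWeight-one B₂) (rescale-by-one B₂))
  τ-conj : ((τ ⊗ τ) ⊗ B) ⊗ (τ⁻¹ ⊗ τ⁻¹) ≐ rescale flip₀₁ B₂
  τ-conj = ≐-trans (cyclicShift-conjugate² (- + 1) B) (rescale-congˡ shiftWeight-minusOne B₂)
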